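{- Let $F$ be a fork with point of return $r$, and let $v_1\prec\dots\prec v_{n-1}$ be the unique acyclic ordering of $F\setminus\{r\}$. For $j\le n-1$ let $\mathbf w=[v_1,\dots,v_j,r]$ and $F'=\mu_{\mathbf w}(F)$. Then $F'\setminus\{v_j\}$ has the unique acyclic ordering $v_{j+1}\prec\dots\prec v_{n-1}\prec v_1\prec\dots\prec v_{j-1}\prec r$, and $F'\setminus\{r\}$ has the unique acyclic ordering $v_j\prec v_{j+1}\prec\dots\prec v_{n-1}\prec v_1\prec\dots\prec v_{j-1}$.
   Context: A quiver is a finite directed multigraph without loops or 2-cycles; $f_{ij}$ is the number of arrows $i\to j$, taken negative if arrows go $j\to i$. Mutation at $k$: add an arrow $a\to b$ for each path $a\to k\to b$, reverse all arrows at $k$, remove 2-cycles; $\mu_{[i_1,\dots,i_m]}$ mutates at $i_1$ first, then $i_2$, etc. $F\setminus V$ denotes the full subquiver on the vertices not in $V$. Abundant: at least two arrows between every pair of distinct vertices; acyclic: no directed cycle. An acyclic ordering is a total order $\prec$ with $v_i\prec v_j$ whenever there is an arrow $v_i\to v_j$. A fork is an abundant, non-acyclic quiver $F$ with a vertex $r$ (point of return) such that for all $i\in F^-(r)$ (vertices with arrows to $r$) and $j\in F^+(r)$ (vertices with arrows from $r$), $f_{ji}>f_{ir}$ and $f_{ji}>f_{rj}$, and $F\setminus\{r\}$ is acyclic. -}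

module Defs where

open import Data.Nat using (ℕ; zero; suc; _≤_)
open import Data.Integer using (ℤ; +_; -[1+_]; _+_; _-_; _*_; -_; ∣_∣; _<_)
open import Data.Fin using (Fin; _≟_) renaming (_<_ to _<ᶠ_)
open import Data.List using (List; []; _∷_; length; lookup)
open import Data.List.Membership.Propositional using (_∈_)
open import Data.List.Relation.Unary.Unique.Propositional using (Unique)
open import Data.Product using (_×_; ∃)
open import Data.Unit using (⊤)
open import Relation.Nullary using (¬_; yes; no)
open import Relation.Binary.PropositionalEquality using (_≡_; _≢_)

-- A quiver on the vertex set Fin n, given by its signed arrow counts f i j
-- (number of arrows i → j, negative if arrows go j → i).
Quiver : ℕ → Set
Quiver n = Fin n → Fin n → ℤ

-- Well-formedness: skew-symmetry (this forces f i i = 0: no loops; and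
-- net counts mean no 2-cycles).
IsQuiver : ∀ {n} → Quiver n → Set
IsQuiver {n} f = (i j : Fin n) → f j i ≡ - f i j

Arrow : ∀ {n} → Quiver n → Fin n → Fin n → Set
Arrow f a b = + 0 < f a b

pos : ℤ → ℤ
pos (+ k) = + k
pos -[1+ k ] = + 0

-- Mutation at k: reverse arrows at k; for i,j ≠ k add one arrow i → j for
-- each path i → k → j (and one arrow j → i for each path j → k → i),
-- 2-cycles cancelling in the net count.
mutate : ∀ {n} → Fin n → Quiver n → Quiver n
mutate k f i j with i ≟ k | j ≟ k
... | yes _ | _     = - f i j
... | no _  | yes _ = - f i j
... | no _  | no _  = f i j + pos (f i k) * pos (f k j) - pos (f j k) * pos (f k i)

-- μ_[i1,...,im]: mutate at i1 first, then i2, etc.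
mutateSeq : ∀ {n} → List (Fin n) → Quiver n → Quiver n
mutateSeq []       f = f
mutateSeq (k ∷ ks) f = mutateSeq ks (mutate k f)

-- Directed paths (of length ≥ 1) in the full subquiver on the vertices
-- satisfying S.
data Path {n} (f : Quiver n) (S : Fin n → Set) : Fin n → Fin n → Set where
  edge : ∀ {a b} → S a → S b → Arrow f a b → Path f S a b
  step : ∀ {a b c} → S a → Arrow f a b → Path f S b c → Path f S a c

AcyclicOn : ∀ {n} → Quiver n → (Fin n → Set) → Set
AcyclicOn f S = ¬ ∃ λ a → Path f S a a

everything : ∀ {n} → Fin n → Set
everything _ = ⊤

Acyclic : ∀ {n} → Quiver n → Set
Acyclic f = AcyclicOn f everything

Abundant : ∀ {n} → Quiver n → Set
Abundant {n} f = (i j : Fin n) → i ≢ j → 2 ≤ ∣ f i j ∣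

IsFork : ∀ {n} → Quiver n → Fin n → Set
IsFork {n} f r =
  IsQuiver f × Abundant f × ¬ Acyclic f ×
  ((i j : Fin n) → Arrow f i r → Arrow f r j → (f i r < f j i) × (f r j < f j i)) ×
  AcyclicOn f (λ v → v ≢ r)

-- ℓ = [u_0, ..., u_{k-1}] is an acyclic ordering u_0 ≺ ... ≺ u_{k-1} of the
-- full subquiver on the vertices satisfying S: it lists each such vertex
-- exactly once, and every arrow u_a → u_b has a < b.
IsAcyclicOrdering : ∀ {n} → Quiver n → (Fin n → Set) → List (Fin n) → Set
IsAcyclicOrdering {n} f S ℓ =
  Unique ℓ ×
  ((v : Fin n) → v ∈ ℓ → S v) ×
  ((v : Fin n) → S v → v ∈ ℓ) ×
  ((a b : Fin (length ℓ)) → Arrow f (lookup ℓ a) (lookup ℓ b) → a <ᶠ b)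

IsUniqueAcyclicOrdering : ∀ {n} → Quiver n → (Fin n → Set) → List (Fin n) → Set
IsUniqueAcyclicOrdering f S ℓ =
  IsAcyclicOrdering f S ℓ × (∀ ℓ′ → IsAcyclicOrdering f S ℓ′ → ℓ′ ≡ ℓ)

-- Record a fork F with point of return r by its layout: the acyclic ordering of F ∖ {r}
-- is A ++ B with A = F⁺(r) and B = F⁻(r), and every vertex has at least two arrows to
-- every later one.  If a vertex k has a single in-neighbour p and all other vertices come
-- after k, mutating at k makes k the point of return: arrows between out-neighbours of k
-- are unchanged, while the count p → y becomes f p y + f p k · f k y, which exceeds both
-- f p k and f k y.  Mutating at v₁, …, v_j and then r applies this step j + 1 times, and
-- each resulting list is the unique acyclic ordering because any two of its vertices are
-- joined by arrows pointing forward.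
module Submission where

open import Defs
open import Data.Nat using (ℕ; suc; zero)
open import Data.Fin using (Fin; toℕ)
open import Data.List using (List; []; _∷_; _++_; take; drop; length; lookup)
open import Relation.Binary.PropositionalEquality using (_≢_)
open import Data.Product using (_×_)

open import Data.Empty using (⊥; ⊥-elim)
open import Data.Nat using (z≤n; s≤s; s<s⁻¹)
open import Data.Fin using (_≟_) renaming (zero to fzero; suc to fsuc; _<_ to _<ᶠ_)
import Data.Fin.Properties as Fin
open import Data.Integer using (+_; -[1+_]; _+_; _-_; _*_; -_; _≤_; _<_; +≤+; +<+; nonNegative)
import Data.Integer.Properties as ℤ
open import Data.Integer.Tactic.RingSolver using (solve-∀)
open import Data.List.Membership.Propositional using (_∈_)
open import Data.List.Membership.Propositional.Properties using (∈-++⁻; ∈-lookup)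
open import Data.List.Relation.Binary.Permutation.Propositional using (_↭_; ↭⇒↭ₛ; swap; refl)
open import Data.List.Relation.Binary.Permutation.Propositional.Properties using (∈-resp-↭; ∷↭∷ʳ)
import Data.List.Relation.Binary.Permutation.Setoid.Properties as PermutationSetoid
open import Data.List.Relation.Unary.All as All using (All; []; _∷_)
open import Data.List.Relation.Unary.AllPairs as AllPairs using (AllPairs; []; _∷_)
import Data.List.Relation.Unary.AllPairs.Properties as AllPairs
open import Data.List.Relation.Unary.Any as Any using (here; there; index)
open import Data.List.Relation.Unary.Any.Properties using (lookup-index)
open import Data.List.Relation.Unary.Unique.Propositional using (Unique)
import Data.List.Properties as List
open import Data.Product as Product using (Σ; ∃₂; _,_; proj₁; proj₂)
open import Data.Sum using (_⊎_; inj₁; inj₂)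
open import Function using (_∘_)
open import Relation.Binary.Definitions using (tri<; tri≈; tri>)
open import Relation.Binary.PropositionalEquality
  using (_≡_; refl; sym; trans; cong; cong₂; subst; subst₂; setoid; module ≡-Reasoning)
open import Relation.Nullary using (¬_; yes; no; Dec)

private
  variable
    n : ℕ
    f : Quiver n
    a b i j k p r x y : Fin n
    A B L R : List (Fin n)
    S : Fin n → Set

pos-nonNeg : ∀ {z} → + 0 ≤ z → pos z ≡ z
pos-nonNeg (+≤+ _) = refl

pos-neg : ∀ {z} → + 0 ≤ z → pos (- z) ≡ + 0
pos-neg {+ zero}  _ = refl
pos-neg {+ suc _} _ = refl

2≤⇒0< : ∀ {z} → + 2 ≤ z → + 0 < z
2≤⇒0< = ℤ.<-≤-trans (+<+ (s≤s z≤n))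

2≤⇒0≤ : ∀ {z} → + 2 ≤ z → + 0 ≤ z
2≤⇒0≤ = ℤ.<⇒≤ ∘ 2≤⇒0<

-nonNeg<pos : ∀ {X Z} → + 0 ≤ X → + 0 < Z → - X < Z
-nonNeg<pos 0≤X = ℤ.≤-<-trans (ℤ.neg-mono-≤ 0≤X)

-- Z + X * Y is the arrow count f p y + f p k * f k y after mutating at k.
mutation-sum-dominatesˡ : ∀ {X Y Z} → + 2 ≤ X → + 2 ≤ Y → - X < Z →
  X < Z + X * Y × Y < Z + X * Y
mutation-sum-dominatesˡ {X} {Y} {Z} 2≤X 2≤Y -X<Z = dominates X≤X[Y-1] , dominates Y≤X[Y-1]
  where
  open ℤ.≤-Reasoning
  split-product : ∀ X Y Z → Z + X * Y ≡ (Z + X) + X * (Y - + 1)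
  split-product = solve-∀
  predecessor : ∀ Y → Y ≡ + 1 + (Y - + 1)
  predecessor = solve-∀
  double : ∀ Y → Y + Y ≡ + 2 * Y
  double = solve-∀
  1≤Y-1 : + 1 ≤ Y - + 1
  1≤Y-1 = ℤ.+-monoˡ-≤ (- + 1) 2≤Y
  0≤Y-1 : + 0 ≤ Y - + 1
  0≤Y-1 = ℤ.≤-trans (+≤+ z≤n) 1≤Y-1
  0<Z+X : + 0 < Z + X
  0<Z+X = subst (_< Z + X) (ℤ.+-inverseˡ X) (ℤ.+-monoˡ-< X -X<Z)
  X≤X[Y-1] : X ≤ X * (Y - + 1)
  X≤X[Y-1] = begin
    X             ≡⟨ sym (ℤ.*-identityʳ X) ⟩
    X * + 1       ≤⟨ ℤ.*-monoˡ-≤-nonNeg X {{nonNegative (2≤⇒0≤ 2≤X)}} 1≤Y-1 ⟩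
    X * (Y - + 1) ∎
  Y≤X[Y-1] : Y ≤ X * (Y - + 1)
  Y≤X[Y-1] = begin
    Y                     ≡⟨ predecessor Y ⟩
    + 1 + (Y - + 1)       ≤⟨ ℤ.+-monoˡ-≤ (Y - + 1) 1≤Y-1 ⟩
    (Y - + 1) + (Y - + 1) ≡⟨ double (Y - + 1) ⟩
    + 2 * (Y - + 1)       ≤⟨ ℤ.*-monoʳ-≤-nonNeg (Y - + 1) {{nonNegative 0≤Y-1}} 2≤X ⟩
    X * (Y - + 1)         ∎
  dominates : ∀ {W} → W ≤ X * (Y - + 1) → W < Z + X * Y
  dominates {W} W≤ = begin-strict
    W                       ≡⟨ sym (ℤ.+-identityˡ W) ⟩
    + 0 + W                 <⟨ ℤ.+-mono-<-≤ 0<Z+X W≤ ⟩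
    (Z + X) + X * (Y - + 1) ≡⟨ sym (split-product X Y Z) ⟩
    Z + X * Y               ∎

mutation-sum-dominates : ∀ {X Y Z} → + 2 ≤ X → + 2 ≤ Y → - X < Z ⊎ - Y < Z →
  X < Z + X * Y × Y < Z + X * Y
mutation-sum-dominates 2≤X 2≤Y (inj₁ -X<Z) = mutation-sum-dominatesˡ 2≤X 2≤Y -X<Z
mutation-sum-dominates {X} {Y} {Z} 2≤X 2≤Y (inj₂ -Y<Z) =
  subst (λ W → X < Z + W × Y < Z + W) (ℤ.*-comm Y X) (Product.swap (mutation-sum-dominatesˡ 2≤Y 2≤X -Y<Z))

Arrow₂ : Quiver n → Fin n → Fin n → Set
Arrow₂ f a b = + 2 ≤ f a b

Chain : Quiver n → List (Fin n) → Set
Chain f = AllPairs (Arrow₂ f)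

module _ {n : ℕ} {f : Quiver n} (skew : IsQuiver f) where

  no-arrow-back : + 0 ≤ f a b → ¬ Arrow f b a
  no-arrow-back {a} {b} 0≤fab 0<fba =
    ℤ.<-irrefl refl (ℤ.<-≤-trans 0<fba (subst (_≤ + 0) (sym (skew a b)) (ℤ.neg-mono-≤ 0≤fab)))

  no-loop : ¬ Arrow f a a
  no-loop arrow = no-arrow-back (ℤ.<⇒≤ arrow) arrow

  abundant⇒arrow₂ : Abundant f → a ≢ b → Arrow₂ f a b ⊎ Arrow₂ f b a
  abundant⇒arrow₂ {a} {b} abundant a≢b with f a b | skew a b | abundant a b a≢b
  ... | + _     | _    | 2≤ = inj₁ (+≤+ 2≤)
  ... | -[1+ _ ] | fba≡ | 2≤ = inj₂ (subst (+ 2 ≤_) (sym fba≡) (+≤+ 2≤))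

  negate-fork-bound : ∀ {X} → f y r < X → - X < f r y
  negate-fork-bound {y} {r} fyr<X = subst (- _ <_) (sym (skew y r)) (ℤ.neg-mono-< fyr<X)

  mutate-row : (k j : Fin n) → mutate k f k j ≡ f j k
  mutate-row k j with k ≟ k
  ... | yes _  = sym (skew k j)
  ... | no k≢k = ⊥-elim (k≢k refl)

  mutate-column : (k i : Fin n) → mutate k f i k ≡ f k i
  mutate-column k i with i ≟ k | k ≟ k
  ... | yes _ | _      = sym (skew i k)
  ... | no _  | yes _  = sym (skew i k)
  ... | no _  | no k≢k = ⊥-elim (k≢k refl)

  mutate-elsewhere : i ≢ k → j ≢ k →
    mutate k f i j ≡ f i j + pos (f i k) * pos (f k j) - pos (f j k) * pos (f k i)
  mutate-elsewhere {i} {k} {j} i≢k j≢k with i ≟ k | j ≟ k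
  ... | yes i≡k | _       = ⊥-elim (i≢k i≡k)
  ... | no _    | yes j≡k = ⊥-elim (j≢k j≡k)
  ... | no _    | no _    = refl

  mutate-skew : IsQuiver (mutate k f)
  mutate-skew {k} i j = by-cases (i ≟ k) (j ≟ k)
    where
    open ≡-Reasoning
    negate : ∀ a b c → - a + b - c ≡ - (a + c - b)
    negate = solve-∀
    by-cases : Dec (i ≡ k) → Dec (j ≡ k) → mutate k f j i ≡ - mutate k f i j
    by-cases (yes refl) _          = trans (mutate-column k j) (trans (skew j k) (cong -_ (sym (mutate-row k j))))
    by-cases (no _)     (yes refl) = trans (mutate-row k i) (trans (skew k i) (cong -_ (sym (mutate-column k i))))
    by-cases (no i≢k)   (no j≢k)   = begin
      mutate k f j i           ≡⟨ mutate-elsewhere j≢k i≢k ⟩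
      f j i + j→i - i→j        ≡⟨ cong (λ z → z + j→i - i→j) (skew i j) ⟩
      - f i j + j→i - i→j      ≡⟨ negate (f i j) j→i i→j ⟩
      - (f i j + i→j - j→i)    ≡⟨ cong -_ (sym (mutate-elsewhere i≢k j≢k)) ⟩
      - mutate k f i j         ∎
      where
      i→j = pos (f i k) * pos (f k j)
      j→i = pos (f j k) * pos (f k i)

  pos-against-arrow : + 0 ≤ f a b → pos (f b a) ≡ + 0
  pos-against-arrow {a} {b} 0≤fab = trans (cong pos (skew a b)) (pos-neg 0≤fab)

  mutate-into-out-neighbour : + 0 ≤ f k j → i ≢ k → j ≢ k →
    mutate k f i j ≡ f i j + pos (f i k) * pos (f k j)
  mutate-into-out-neighbour {k} {j} {i} 0≤fkj i≢k j≢k = begin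
    mutate k f i j                   ≡⟨ mutate-elsewhere i≢k j≢k ⟩
    i→k→j - pos (f j k) * pos (f k i) ≡⟨ cong (λ z → i→k→j - z * pos (f k i)) (pos-against-arrow 0≤fkj) ⟩
    i→k→j - + 0 * pos (f k i)         ≡⟨ ℤ.+-identityʳ i→k→j ⟩
    i→k→j                             ∎
    where
    open ≡-Reasoning
    i→k→j = f i j + pos (f i k) * pos (f k j)

  mutate-between-out-neighbours : + 0 ≤ f k i → + 0 ≤ f k j → i ≢ k → j ≢ k → mutate k f i j ≡ f i j
  mutate-between-out-neighbours {k} {i} {j} 0≤fki 0≤fkj i≢k j≢k = begin
    mutate k f i j                    ≡⟨ mutate-into-out-neighbour 0≤fkj i≢k j≢k ⟩
    f i j + pos (f i k) * pos (f k j) ≡⟨ cong (λ z → f i j + z * pos (f k j)) (pos-against-arrow 0≤fki) ⟩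
    f i j + + 0                       ≡⟨ ℤ.+-identityʳ (f i j) ⟩
    f i j                             ∎
    where open ≡-Reasoning

  mutate-along-path : + 0 ≤ f p k → + 0 ≤ f k j → p ≢ k → j ≢ k →
    mutate k f p j ≡ f p j + f p k * f k j
  mutate-along-path {p} {k} {j} 0≤fpk 0≤fkj p≢k j≢k =
    trans (mutate-into-out-neighbour 0≤fkj p≢k j≢k)
          (cong₂ (λ u v → f p j + u * v) (pos-nonNeg 0≤fpk) (pos-nonNeg 0≤fkj))

lookup-AllPairs : ∀ {A : Set} {R : A → A → Set} {L : List A} → AllPairs R L →
  ∀ {i j} → i <ᶠ j → R (lookup L i) (lookup L j)
lookup-AllPairs (Rx ∷ _)  {fzero}  {fsuc j} _         = All.lookup Rx (∈-lookup j)
lookup-AllPairs (_ ∷ RL)  {fsuc i} {fsuc j} (s≤s i<j) = lookup-AllPairs RL i<j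

split-sorted : ∀ {X : Set} {P Q : X → Set} (L : List X) → All (λ v → P v ⊎ Q v) L →
  AllPairs (λ x y → Q x → P y → ⊥) L → ∃₂ λ B C → L ≡ B ++ C × All P B × All Q C
split-sorted []      []               []            = [] , [] , refl , [] , []
split-sorted (x ∷ L) (inj₁ Px ∷ sides) (_ ∷ sorted) with split-sorted L sides sorted
... | B , C , refl , PB , QC = x ∷ B , C , refl , Px ∷ PB , QC
split-sorted {P = P} {Q} (x ∷ L) (inj₂ Qx ∷ sides) (x-first ∷ _) =
  [] , x ∷ L , refl , [] , Qx ∷ All.zipWith later-Q (sides , x-first)
  where
  later-Q : ∀ {y} → (P y ⊎ Q y) × (Q x → P y → ⊥) → Q y
  later-Q (inj₁ Py , clash) = ⊥-elim (clash Qx Py)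
  later-Q (inj₂ Qy , _)     = Qy

EnumeratesOn : (Fin n → Set) → List (Fin n) → Set
EnumeratesOn {n} S L = Unique L × ((v : Fin n) → v ∈ L → S v) × ((v : Fin n) → S v → v ∈ L)

Enumerates : List (Fin n) → Set
Enumerates {n} L = Unique L × ((v : Fin n) → v ∈ L)

enumerates-resp-↭ : ∀ {L L′ : List (Fin n)} → L ↭ L′ → Enumerates L → Enumerates L′
enumerates-resp-↭ {n} σ (unique , complete) =
  PermutationSetoid.Unique-resp-↭ (setoid (Fin n)) (↭⇒↭ₛ σ) unique , λ v → ∈-resp-↭ σ (complete v)

enumerates-∷ : Enumerates (x ∷ L) → EnumeratesOn (_≢ x) L
enumerates-∷ (x∉L ∷ unique , complete) =
  unique , (λ v v∈L v≡x → All.lookup x∉L v∈L (sym v≡x)) , (λ v v≢x → Any.tail v≢x (complete v))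

enumeratesOn-∷ : EnumeratesOn S (x ∷ L) → EnumeratesOn (λ v → S v × v ≢ x) L
enumeratesOn-∷ (x∉L ∷ unique , sound , complete) =
    unique
  , (λ v v∈L → sound v (there v∈L) , λ v≡x → All.lookup x∉L v∈L (sym v≡x))
  , (λ v (Sv , v≢x) → Any.tail v≢x (complete v Sv))

path-source : Path f S a b → S a
path-source (edge Sa _ _) = Sa
path-source (step Sa _ _) = Sa

ordered-cover⇒acyclicOn : (∀ v → S v → v ∈ L) →
  (∀ i j → Arrow f (lookup L i) (lookup L j) → i <ᶠ j) → AcyclicOn f S
ordered-cover⇒acyclicOn {S = S} {L = L} {f = f} complete forward (a , cycle) =
  Fin.<-irrefl refl (path-forward cycle a∈L a∈L)
  where
  a∈L : a ∈ L
  a∈L = complete a (path-source cycle)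
  arrow-forward : ∀ {b c} (b∈L : b ∈ L) (c∈L : c ∈ L) → Arrow f b c → index b∈L <ᶠ index c∈L
  arrow-forward b∈L c∈L = forward _ _ ∘ subst₂ (Arrow f) (lookup-index b∈L) (lookup-index c∈L)
  path-forward : ∀ {b c} → Path f S b c → (b∈L : b ∈ L) (c∈L : c ∈ L) → index b∈L <ᶠ index c∈L
  path-forward (edge _ _ arrow) b∈L c∈L = arrow-forward b∈L c∈L arrow
  path-forward (step {b = d} _ arrow path) b∈L c∈L =
    Fin.<-trans (arrow-forward b∈L d∈L arrow) (path-forward path d∈L c∈L)
    where
    d∈L : d ∈ L
    d∈L = complete d (path-source path)

module _ {n : ℕ} {f : Quiver n} where

  chain⇒arrows-forward : IsQuiver f → Chain f L → ∀ i j → Arrow f (lookup L i) (lookup L j) → i <ᶠ j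
  chain⇒arrows-forward skew chain i j arrow with Fin.<-cmp i j
  ... | tri< i<j _ _ = i<j
  ... | tri≈ _ refl _ = ⊥-elim (no-loop skew arrow)
  ... | tri> _ _ j<i = ⊥-elim (no-arrow-back skew (2≤⇒0≤ (lookup-AllPairs chain j<i)) arrow)

  acyclicOrdering-∷ : IsAcyclicOrdering f S (x ∷ L) → IsAcyclicOrdering f (λ v → S v × v ≢ x) L
  acyclicOrdering-∷ (unique , sound , complete , forward) =
    Product.map₂ (Product.map₂ (_, λ i j arrow → s<s⁻¹ (forward (fsuc i) (fsuc j) arrow)))
      (enumeratesOn-∷ (unique , sound , complete))

  no-arrow-to-head : IsAcyclicOrdering f S (y ∷ L) → x ∈ L → ¬ Arrow f x y
  no-arrow-to-head {y = y} (_ , _ , _ , forward) x∈L arrow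
    with forward (fsuc (index x∈L)) fzero (subst (λ z → Arrow f z y) (lookup-index x∈L) arrow)
  ... | ()

  acyclicOrdering⇒chain : IsQuiver f → Abundant f → IsAcyclicOrdering f S L → Chain f L
  acyclicOrdering⇒chain {L = []}    _    _        _  = []
  acyclicOrdering⇒chain {L = x ∷ L} skew abundant ao@(x∉L ∷ _ , _) =
    All.tabulate head-arrow ∷ acyclicOrdering⇒chain skew abundant (acyclicOrdering-∷ ao)
    where
    head-arrow : ∀ {y} → y ∈ L → Arrow₂ f x y
    head-arrow y∈L with abundant⇒arrow₂ skew abundant (All.lookup x∉L y∈L)
    ... | inj₁ x⇉y = x⇉y
    ... | inj₂ y⇉x = ⊥-elim (no-arrow-to-head ao y∈L (2≤⇒0< y⇉x))

  chain-acyclicOrdering-unique : Chain f L → IsAcyclicOrdering f S L →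
    ∀ L′ → IsAcyclicOrdering f S L′ → L′ ≡ L
  chain-acyclicOrdering-unique {[]}    _ _ [] _ = refl
  chain-acyclicOrdering-unique {[]}    _ (_ , _ , complete , _) (y ∷ _) (_ , sound′ , _)
    with complete y (sound′ y (here refl))
  ... | ()
  chain-acyclicOrdering-unique {x ∷ L} _ (_ , sound , _) [] (_ , _ , complete′ , _)
    with complete′ x (sound x (here refl))
  ... | ()
  chain-acyclicOrdering-unique {x ∷ L} (x⇉L ∷ chain) ao@(_ , sound , complete , _)
                                (y ∷ L′) ao′@(_ , sound′ , complete′ , _) with x ≟ y
  ... | yes refl = cong (x ∷_)
    (chain-acyclicOrdering-unique chain (acyclicOrdering-∷ ao) L′ (acyclicOrdering-∷ ao′))
  ... | no x≢y = ⊥-elim (no-arrow-to-head ao′ x∈L′ (2≤⇒0< (All.lookup x⇉L y∈L)))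
    where
    y∈L : y ∈ L
    y∈L = Any.tail (x≢y ∘ sym) (complete y (sound′ y (here refl)))
    x∈L′ : x ∈ L′
    x∈L′ = Any.tail x≢y (complete′ x (sound x (here refl)))

  chain⇒uniqueAcyclicOrdering : IsQuiver f → EnumeratesOn S L → Chain f L → IsUniqueAcyclicOrdering f S L
  chain⇒uniqueAcyclicOrdering skew (unique , sound , complete) chain =
    ao , λ L′ ao′ → chain-acyclicOrdering-unique chain ao L′ ao′
    where
    ao = unique , sound , complete , chain⇒arrows-forward skew chain

record ForkLayout (f : Quiver n) (r : Fin n) (A B : List (Fin n)) : Set where
  field
    quiver      : IsQuiver f
    enumerates  : Enumerates (r ∷ A ++ B)
    chain       : Chain f (A ++ B)
    from-return : ∀ {x} → x ∈ A → Arrow₂ f r x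
    to-return   : ∀ {y} → y ∈ B → Arrow₂ f y r
    fork        : ∀ {x y} → x ∈ A → y ∈ B → f y r < f x y × f r x < f x y

module _ {n : ℕ} {f : Quiver n} (skew : IsQuiver f) where

  mutate-at-head-keeps-tail : Chain f (k ∷ L) → All (_≢ k) L → Chain (mutate k f) L
  mutate-at-head-keeps-tail {L = []}    _                            _              = []
  mutate-at-head-keeps-tail {L = x ∷ L} ((k⇉x ∷ k⇉L) ∷ x⇉L ∷ chain) (x≢k ∷ L≢k) =
    All.tabulate kept ∷ mutate-at-head-keeps-tail (k⇉L ∷ chain) L≢k
    where
    kept : ∀ {y} → y ∈ L → Arrow₂ (mutate _ f) x y
    kept y∈L = subst (+ 2 ≤_)
      (sym (mutate-between-out-neighbours skew (2≤⇒0≤ k⇉x) (2≤⇒0≤ (All.lookup k⇉L y∈L))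
                                               x≢k (All.lookup L≢k y∈L)))
      (All.lookup x⇉L y∈L)

  mutate-pivot : Enumerates (p ∷ k ∷ R) → Arrow₂ f p k → Chain f (k ∷ R) →
    (∀ {y} → y ∈ R → - f p k < f p y ⊎ - f k y < f p y) →
    ForkLayout (mutate k f) k (p ∷ []) R
  mutate-pivot {p} {k} {R} enum@((p≢k ∷ _) ∷ k∉R ∷ _ , _) p⇉k k⇉R@(k⇉R′ ∷ _) bound = record
    { quiver      = mutate-skew skew
    ; enumerates  = enumerates-resp-↭ (swap p k refl) enum
    ; chain       = All.tabulate p⇉y ∷ mutate-at-head-keeps-tail k⇉R R≢k
    ; from-return = λ { (here refl) → subst (+ 2 ≤_) (sym (mutate-row skew k p)) p⇉k }
    ; to-return   = y⇉k
    ; fork        = λ { (here refl) y∈R → fork-inequalities y∈R }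
    }
    where
    R≢k : All (_≢ k) R
    R≢k = All.map (λ k≢y y≡k → k≢y (sym y≡k)) k∉R
    y⇉k : ∀ {y} → y ∈ R → Arrow₂ (mutate k f) y k
    y⇉k {y} y∈R = subst (+ 2 ≤_) (sym (mutate-column skew k y)) (All.lookup k⇉R′ y∈R)
    fork-inequalities : ∀ {y} → y ∈ R →
      mutate k f y k < mutate k f p y × mutate k f k p < mutate k f p y
    fork-inequalities {y} y∈R
      rewrite mutate-column skew k y | mutate-row skew k p
            | mutate-along-path skew (2≤⇒0≤ p⇉k) (2≤⇒0≤ (All.lookup k⇉R′ y∈R))
                                       p≢k (All.lookup R≢k y∈R) =
      Product.swap (mutation-sum-dominates p⇉k (All.lookup k⇉R′ y∈R) (bound y∈R))
    p⇉y : ∀ {y} → y ∈ R → Arrow₂ (mutate k f) p y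
    p⇉y y∈R = ℤ.<⇒≤ (ℤ.≤-<-trans (y⇉k y∈R) (proj₁ (fork-inequalities y∈R)))


module _ {n : ℕ} {f : Quiver n} {r : Fin n} where

  mutate-first-out : ForkLayout f r (a ∷ A) B → ForkLayout (mutate a f) a (r ∷ []) (A ++ B)
  mutate-first-out {a} {A} {B} layout = mutate-pivot quiver enumerates (from-return (here refl)) chain bound
    where
    open ForkLayout layout
    bound : ∀ {y} → y ∈ A ++ B → - f r a < f r y ⊎ - f a y < f r y
    bound y∈A++B with ∈-++⁻ A y∈A++B
    ... | inj₁ y∈A = inj₁ (-nonNeg<pos (2≤⇒0≤ (from-return (here refl)))
                                       (2≤⇒0< (from-return (there y∈A))))
    ... | inj₂ y∈B = inj₂ (negate-fork-bound quiver (proj₁ (fork (here refl) y∈B)))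

  return-last : ForkLayout f r (a ∷ []) B → Chain f (B ++ r ∷ [])
  return-last layout =
    AllPairs.++⁺ (AllPairs.tail chain) ([] ∷ []) (All.tabulate λ y∈B → to-return y∈B ∷ [])
    where open ForkLayout layout

  mutate-first-in : ForkLayout f r (a ∷ []) (b ∷ B) → ForkLayout (mutate b f) b (a ∷ []) (B ++ r ∷ [])
  mutate-first-in {a} {b} {B} layout =
    mutate-pivot quiver (enumerates-resp-↭ (∷↭∷ʳ r (a ∷ b ∷ B)) enumerates)
      (All.lookup (AllPairs.head chain) (here refl)) (return-last layout) bound
    where
    open ForkLayout layout
    bound : ∀ {y} → y ∈ B ++ r ∷ [] → - f a b < f a y ⊎ - f b y < f a y
    bound y∈B∷r with ∈-++⁻ B y∈B∷r
    ... | inj₁ y∈B        = inj₁ (-nonNeg<pos (2≤⇒0≤ (a⇉ (here refl))) (2≤⇒0< (a⇉ (there y∈B))))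
      where a⇉ = All.lookup (AllPairs.head chain)
    ... | inj₂ (here refl) = inj₁ (negate-fork-bound quiver (proj₂ (fork (here refl) (here refl))))

  layout-orderings : ForkLayout f r (a ∷ []) B →
    IsUniqueAcyclicOrdering f (_≢ a) (B ++ r ∷ []) × IsUniqueAcyclicOrdering f (_≢ r) (a ∷ B)
  layout-orderings {a} {B} layout =
      chain⇒uniqueAcyclicOrdering quiver (enumerates-∷ (enumerates-resp-↭ (∷↭∷ʳ r (a ∷ B)) enumerates))
        (return-last layout)
    , chain⇒uniqueAcyclicOrdering quiver (enumerates-∷ enumerates) chain
    where open ForkLayout layout

module _ {n : ℕ} {f : Quiver n} {r : Fin n} where

  complement-enumerates : EnumeratesOn (_≢ r) L → Enumerates (r ∷ L)
  complement-enumerates {L} (unique , sound , complete) =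
    All.tabulate (λ v∈L → sound _ v∈L ∘ sym) ∷ unique , covered
    where
    covered : ∀ v → v ∈ r ∷ L
    covered v with v ≟ r
    ... | yes refl = here refl
    ... | no v≢r   = there (complete v v≢r)

  sink-after-chain⇒acyclic : IsQuiver f → Enumerates (r ∷ L) → Chain f L →
    All (λ y → Arrow₂ f y r) L → Acyclic f
  sink-after-chain⇒acyclic {L} skew (_ , complete) chain L⇉r =
    ordered-cover⇒acyclicOn (λ v _ → ∈-resp-↭ (∷↭∷ʳ r L) (complete v))
      (chain⇒arrows-forward skew (AllPairs.++⁺ chain ([] ∷ []) (All.map (_∷ []) L⇉r)))

  fork-no-return-before-leaving : IsFork f r → Arrow₂ f x y → Arrow₂ f x r → Arrow₂ f r y → ⊥
  fork-no-return-before-leaving (skew , _ , _ , fork , _) x⇉y x⇉r r⇉y = no-arrow-back skew (2≤⇒0≤ x⇉y)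
    (ℤ.<-trans (2≤⇒0< x⇉r) (proj₁ (fork _ _ (2≤⇒0< x⇉r) (2≤⇒0< r⇉y))))

  fork⇒layout : IsFork f r → IsAcyclicOrdering f (_≢ r) L →
    Σ (Fin n) λ a → ∃₂ λ A B → L ≡ a ∷ A ++ B × ForkLayout f r (a ∷ A) B
  fork⇒layout {L} isFork@(skew , abundant , cyclic , fork , _) ao@(unique , sound , complete , _)
    with split-sorted L (All.tabulate (λ v∈L → abundant⇒arrow₂ skew abundant (sound _ v∈L ∘ sym)))
           (AllPairs.map (fork-no-return-before-leaving isFork) (acyclicOrdering⇒chain skew abundant ao))
  ... | [] , B , refl , _ , B⇉r =
    ⊥-elim (cyclic (sink-after-chain⇒acyclic skew (complement-enumerates (unique , sound , complete))
                      (acyclicOrdering⇒chain skew abundant ao) B⇉r))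
  ... | a ∷ A , B , refl , r⇉A , B⇉r = a , A , B , refl , record
    { quiver      = skew
    ; enumerates  = complement-enumerates (unique , sound , complete)
    ; chain       = acyclicOrdering⇒chain skew abundant ao
    ; from-return = All.lookup r⇉A
    ; to-return   = All.lookup B⇉r
    ; fork        = λ x∈A y∈B → fork _ _ (2≤⇒0< (All.lookup B⇉r y∈B)) (2≤⇒0< (All.lookup r⇉A x∈A))
    }

mutateSeq-∷ʳ : (ks : List (Fin n)) (k : Fin n) (f : Quiver n) →
  mutateSeq (ks ++ k ∷ []) f ≡ mutate k (mutateSeq ks f)
mutateSeq-∷ʳ []       k f = refl
mutateSeq-∷ʳ (x ∷ ks) k f = mutateSeq-∷ʳ ks k (mutate x f)

mutateSeq-rotates-layout : (x : Fin n) (post pre : List (Fin n)) (g : Quiver n) →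
  ForkLayout g x (r ∷ []) (post ++ pre) → (k : Fin (suc (length post))) →
  ForkLayout (mutateSeq (take (toℕ k) post) g) (lookup (x ∷ post) k) (r ∷ [])
             (drop (toℕ k) post ++ pre ++ take (toℕ k) (x ∷ post))
mutateSeq-rotates-layout {r = r} x post pre g layout fzero =
  subst (ForkLayout g x (r ∷ [])) (cong (post ++_) (sym (List.++-identityʳ pre))) layout
mutateSeq-rotates-layout {r = r} x (y ∷ post) pre g layout (fsuc k) =
  subst (ForkLayout _ _ (r ∷ []))
        (cong (drop (toℕ k) post ++_) (List.++-assoc pre (x ∷ []) (take (toℕ k) (y ∷ post))))
    (mutateSeq-rotates-layout y post (pre ++ x ∷ []) (mutate y g)
      (subst (ForkLayout (mutate y g) y (r ∷ [])) (List.++-assoc post pre (x ∷ [])) (mutate-first-in layout)) k)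

corollary3p6 : ∀ {n} (F : Quiver n) (r : Fin n) (vs : List (Fin n))
    → IsFork F r
    → IsAcyclicOrdering F (λ v → v ≢ r) vs
    → (j : Fin (length vs))
    → let F′ = mutateSeq (take (suc (toℕ j)) vs ++ r ∷ []) F
          vj = lookup vs j
      in IsUniqueAcyclicOrdering F′ (λ v → v ≢ vj) (drop (suc (toℕ j)) vs ++ take (toℕ j) vs ++ r ∷ [])
       × IsUniqueAcyclicOrdering F′ (λ v → v ≢ r) (vj ∷ drop (suc (toℕ j)) vs ++ take (toℕ j) vs)
corollary3p6 F r vs fork ao j with fork⇒layout fork ao
... | a , A , B , refl , layout =
  subst (λ g → IsUniqueAcyclicOrdering g (_≢ vj) (D ++ T ++ r ∷ [])
             × IsUniqueAcyclicOrdering g (_≢ r) (vj ∷ D ++ T))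
    (sym (mutateSeq-∷ʳ (take (suc (toℕ j)) vs) r F))
    (Product.map₁ (subst (IsUniqueAcyclicOrdering F′ (_≢ vj)) (List.++-assoc D T (r ∷ [])))
                  (layout-orderings final))
  where
  vj = lookup vs j
  D = drop (suc (toℕ j)) vs
  T = take (toℕ j) vs
  after-first : ForkLayout (mutate a F) a (r ∷ []) ((A ++ B) ++ [])
  after-first = subst (ForkLayout (mutate a F) a (r ∷ [])) (sym (List.++-identityʳ (A ++ B)))
                      (mutate-first-out layout)
  F′ = mutate r (mutateSeq (take (suc (toℕ j)) vs) F)
  final : ForkLayout F′ r (vj ∷ []) (D ++ T)
  final = mutate-first-out (mutateSeq-rotates-layout a (A ++ B) [] (mutate a F) after-first j)
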